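{- Let $L=\{l_n\}_{n\ge1}$ and $M=\{m_n\}_{n\ge1}$ be increasing sequences (finite or infinite) of positive even integers, and let $Z=\{z_n\}_{n\ge1}=L\cap M$ be the increasing sequence of their common terms. Let $L(y)=\#\{n:l_n\le y\}$, $M(y)=\#\{n:m_n\le y\}$, $Z(y)=\#\{n:z_n\le y\}$ be the counting functions. For a nonnegative even integer $x$, let $e(x)$ be the number of solutions of $x=l+m$ with $l\in L$, $m\in M$, where the order of the summands is not important; that is, $e(x)$ is the number of pairs $(a,b)$ with $a\le b$, $a+b=x$, such that ($a\in L$ and $b\in M$) or ($a\in M$ and $b\in L$). Then for every even $x\ge2$, $$e(x)=\sum_{m\in M,\ m\le x/2}L(x-m)+\sum_{l\in L,\ l\le x/2}M(x-l)-\sum_{z\in Z,\ z\le x/2}Z(x-z)-L(x/2)\,M(x/2)+\binom{Z(x/2)+1}{2}-e(x-2)-e(x-4)-\dots-e(0).$$ -}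

module Defs where

open import Level using (0ℓ)
open import Data.Nat using (ℕ; suc; _∸_; _*_; _≤_; _≤?_; _<_)
open import Data.Nat.Divisibility using (_∣_)
open import Data.List using (List; length; filter; upTo; map)
open import Data.Nat.ListAction using (sum)
open import Data.Product using (_×_)
open import Data.Sum using (_⊎_)
open import Relation.Unary using (Pred; Decidable)
open import Relation.Nullary.Decidable using (_×-dec_; _⊎-dec_)

DSet : Set₁
DSet = Pred ℕ 0ℓ

-- "an increasing sequence (finite or infinite) of positive even integers",
-- viewed as the set of its terms
PosEvenSet : DSet → Set
PosEvenSet S = ∀ n → S n → (0 < n) × (2 ∣ n)

upToIn : {S : DSet} → Decidable S → ℕ → List ℕ
upToIn S? y = filter S? (upTo (suc y))

count : {S : DSet} → Decidable S → ℕ → ℕ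
count S? y = length (upToIn S? y)

sumIn : {S : DSet} → Decidable S → (ℕ → ℕ) → ℕ → ℕ
sumIn S? f y = sum (map f (upToIn S? y))

_∩_ : DSet → DSet → DSet
(L ∩ M) n = L n × M n

_∩?_ : {L M : DSet} → Decidable L → Decidable M → Decidable (L ∩ M)
(L? ∩? M?) n = L? n ×-dec M? n

-- unordered representations: pairs (a , b) with a ≤ b, a + b = x,
-- (a ∈ L and b ∈ M) or (a ∈ M and b ∈ L); b is determined as x ∸ a.
ReprAt : DSet → DSet → ℕ → Pred ℕ 0ℓ
ReprAt L M x a = (a ≤ x ∸ a) × ((L a × M (x ∸ a)) ⊎ (M a × L (x ∸ a)))

reprAt? : {L M : DSet} → Decidable L → Decidable M → (x : ℕ) → Decidable (ReprAt L M x)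
reprAt? L? M? x a = (a ≤? x ∸ a) ×-dec ((L? a ×-dec M? (x ∸ a)) ⊎-dec (M? a ×-dec L? (x ∸ a)))

e : {L M : DSet} → Decidable L → Decidable M → ℕ → ℕ
e L? M? x = length (filter (reprAt? L? M? x) (upTo (suc x)))

-- e(x-2) + e(x-4) + ... + e(x - 2h) where h = x/2 (last term e(0) for even x)
ePrevSum : {L M : DSet} → Decidable L → Decidable M → ℕ → ℕ → ℕ
ePrevSum L? M? x h = sum (map (λ k → e L? M? (x ∸ 2 * suc k)) (upTo h))

{-# OPTIONS --safe #-}

-- Summing e over all y ≤ x counts the pairs a ≤ b with a + b ≤ x in which one
-- entry lies in L and the other in M; since L and M consist of even numbers,
-- e vanishes at odd arguments, so this sum is e(x) + e(x-2) + … + e(0).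
-- Count the same pairs by their smaller entry a ≤ x/2: for fixed a,
-- inclusion–exclusion over b ≤ x - a gives
-- [a ∈ M] L(x-a) + [a ∈ L] M(x-a) - [a ∈ Z] Z(x-a) pairs, from which those with
-- b < a must be removed.  Summed over a ≤ x/2, these number
-- L(x/2) M(x/2) - (Z(x/2)+1 choose 2), by splitting the square [0, x/2]² into
-- its two strict triangles and its diagonal.

module Submission where

open import Defs
open import Relation.Unary using (Decidable)

module FiniteSums where
  open import Data.Bool using (Bool; true; false; _∧_)
  open import Data.List using (List; []; _∷_; [_]; _++_; length; filter; map; upTo)
  open import Data.List.Properties using (upTo-∷ʳ; filter-++; map-++)
  open import Data.Nat
  open import Data.Nat.Combinatorics using (_C_; nC1≡n; nCk+nC[k+1]≡[n+1]C[k+1])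
  open import Data.Nat.ListAction using (sum)
  open import Data.Nat.ListAction.Properties using (sum-++)
  open import Data.Nat.Properties
  open import Algebra.Properties.CommutativeSemigroup +-commutativeSemigroup
    using (interchange; xy∙z≈xz∙y)
  open import Data.Nat.Tactic.RingSolver using (solve-∀)
  open import Data.Sum using (inj₁; inj₂)
  open import Function using (_∘_)
  open import Relation.Nullary using (does)
  open import Relation.Nullary.Decidable using (dec-true; dec-false)
  open import Relation.Unary using (Pred)
  open import Relation.Binary.PropositionalEquality hiding ([_])
  open ≡-Reasoning

  ∑< : ℕ → (ℕ → ℕ) → ℕ
  ∑< zero    f = 0
  ∑< (suc n) f = ∑< n f + f n

  infix 5 ∑<
  syntax ∑< n (λ i → t) = ∑[ i < n ] t

  ∑-cong : ∀ {f g : ℕ → ℕ} n → (∀ i → i < n → f i ≡ g i) → ∑< n f ≡ ∑< n g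
  ∑-cong zero    f≗g = refl
  ∑-cong (suc n) f≗g =
    cong₂ _+_ (∑-cong n (λ i i<n → f≗g i (m<n⇒m<1+n i<n))) (f≗g n (n<1+n n))

  ∑-zero : ∀ {f : ℕ → ℕ} n → (∀ i → i < n → f i ≡ 0) → ∑< n f ≡ 0
  ∑-zero zero    f≗0 = refl
  ∑-zero (suc n) f≗0 =
    cong₂ _+_ (∑-zero n (λ i i<n → f≗0 i (m<n⇒m<1+n i<n))) (f≗0 n (n<1+n n))

  ∑-vanishing-tail : ∀ (f : ℕ → ℕ) {m n} → m ≤ n → (∀ i → m ≤ i → f i ≡ 0) →
                     ∑< n f ≡ ∑< m f
  ∑-vanishing-tail f {n = zero}  z≤n   f≗0 = refl
  ∑-vanishing-tail f {n = suc n} m≤1+n f≗0 with m≤n⇒m<n∨m≡n m≤1+n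
  ... | inj₂ refl      = refl
  ... | inj₁ (s≤s m≤n) =
    trans (cong₂ _+_ (∑-vanishing-tail f m≤n f≗0) (f≗0 n m≤n)) (+-identityʳ _)

  ∑-distrib-+ : ∀ (f g : ℕ → ℕ) n → ∑[ i < n ] (f i + g i) ≡ ∑< n f + ∑< n g
  ∑-distrib-+ f g zero    = refl
  ∑-distrib-+ f g (suc n) =
    trans (cong (_+ (f n + g n)) (∑-distrib-+ f g n)) (interchange (∑< n f) (∑< n g) (f n) (g n))

  ∑-*ˡ : ∀ c (f : ℕ → ℕ) n → ∑[ i < n ] (c * f i) ≡ c * ∑< n f
  ∑-*ˡ c f zero    = sym (*-zeroʳ c)
  ∑-*ˡ c f (suc n) =
    trans (cong (_+ c * f n) (∑-*ˡ c f n)) (sym (*-distribˡ-+ c _ (f n)))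

  ∑-head : ∀ (f : ℕ → ℕ) n → ∑< (suc n) f ≡ f 0 + (∑[ i < n ] f (suc i))
  ∑-head f zero    = +-comm 0 (f 0)
  ∑-head f (suc n) = trans (cong (_+ f (suc n)) (∑-head f n)) (+-assoc (f 0) _ _)

  ∑-reverse : ∀ (f : ℕ → ℕ) n → ∑[ k < n ] f (n ∸ suc k) ≡ ∑< n f
  ∑-reverse f zero    = refl
  ∑-reverse f (suc n) = begin
    ∑[ k < suc n ] f (suc n ∸ suc k)  ≡⟨ ∑-head _ n ⟩
    f n + (∑[ k < n ] f (n ∸ suc k))  ≡⟨ cong (f n +_) (∑-reverse f n) ⟩
    f n + ∑< n f                      ≡⟨ +-comm (f n) _ ⟩
    ∑< (suc n) f                      ∎

  ∑-even-terms : ∀ (f : ℕ → ℕ) → (∀ k → f (suc (2 * k)) ≡ 0) →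
                 ∀ h → ∑[ k < suc h ] f (2 * k) ≡ ∑< (suc (2 * h)) f
  ∑-even-terms f odd≡0 zero    = refl
  ∑-even-terms f odd≡0 (suc h) = begin
      (∑[ k < suc h ] f (2 * k)) + f (2 * suc h)
    ≡⟨ cong₂ _+_ (∑-even-terms f odd≡0 h) (cong f (*-suc 2 h)) ⟩
      ∑< (suc (2 * h)) f + f (2 + 2 * h)
    ≡⟨ cong (_+ f (2 + 2 * h)) (trans (cong (∑< (suc (2 * h)) f +_) (odd≡0 h)) (+-identityʳ _)) ⟨
      ∑< (suc (suc (2 * h))) f + f (2 + 2 * h)
    ≡⟨ cong (λ m → ∑< (suc m) f) (*-suc 2 h) ⟨
      ∑< (suc (2 * suc h)) f
    ∎

  ∑-antidiagonals : ∀ (g : ℕ → ℕ → ℕ) n →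
    ∑[ y < suc n ] ∑[ a < suc y ] g a (y ∸ a) ≡ ∑[ a < suc n ] ∑[ b < suc (n ∸ a) ] g a b
  ∑-antidiagonals g zero    = refl
  ∑-antidiagonals g (suc n) = begin
      (∑[ y < suc n ] ∑[ a < suc y ] g a (y ∸ a)) + (D + g (suc n) (n ∸ n))
    ≡⟨ cong (_+ (D + g (suc n) (n ∸ n))) (∑-antidiagonals g n) ⟩
      R + (D + g (suc n) (n ∸ n))
    ≡⟨ +-assoc R D _ ⟨
      R + D + g (suc n) (n ∸ n)
    ≡⟨ cong₂ _+_ (trans (sym (∑-distrib-+ _ _ (suc n))) (∑-cong (suc n) column))
                 (sym (cong (λ m → ∑< m (g (suc n)) + g (suc n) (n ∸ n)) (n∸n≡0 n))) ⟩
      ∑[ a < suc (suc n) ] ∑[ b < suc (suc n ∸ a) ] g a b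
    ∎
    where
    D R : ℕ
    D = ∑[ a < suc n ] g a (suc n ∸ a)
    R = ∑[ a < suc n ] ∑[ b < suc (n ∸ a) ] g a b
    column : ∀ a → a < suc n →
             (∑[ b < suc (n ∸ a) ] g a b) + g a (suc n ∸ a) ≡ ∑[ b < suc (suc n ∸ a) ] g a b
    column a (s≤s a≤n) = sym (cong (λ m → ∑< m (g a) + g a (suc n ∸ a)) (+-∸-assoc 1 a≤n))

  ∑*∑ : ∀ (f g : ℕ → ℕ) n →
        ∑< n f * ∑< n g ≡ (∑[ a < n ] (f a * ∑< a g + g a * ∑< a f)) + (∑[ a < n ] (f a * g a))
  ∑*∑ f g zero    = refl
  ∑*∑ f g (suc n) = begin
      (F + f n) * (G + g n)
    ≡⟨ expand F G (f n) (g n) ⟩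
      F * G + (f n * G + g n * F) + f n * g n
    ≡⟨ cong (λ t → t + (f n * G + g n * F) + f n * g n) (∑*∑ f g n) ⟩
      T + D + (f n * G + g n * F) + f n * g n
    ≡⟨ regroup T D (f n * G + g n * F) (f n * g n) ⟩
      (T + (f n * G + g n * F)) + (D + f n * g n)
    ∎
    where
    F G T D : ℕ
    F = ∑< n f
    G = ∑< n g
    T = ∑[ a < n ] (f a * ∑< a g + g a * ∑< a f)
    D = ∑[ a < n ] (f a * g a)
    expand : ∀ a b c d → (a + c) * (b + d) ≡ a * b + (c * b + d * a) + c * d
    expand = solve-∀
    regroup : ∀ t s x y → t + s + x + y ≡ (t + x) + (s + y)
    regroup = solve-∀

  𝟙 : Bool → ℕ
  𝟙 true  = 1
  𝟙 false = 0

  𝟙-∧ : ∀ x y → 𝟙 (x ∧ y) ≡ 𝟙 x * 𝟙 y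
  𝟙-∧ true  y = sym (+-identityʳ (𝟙 y))
  𝟙-∧ false y = refl

  χ : ∀ {p} {P : Pred ℕ p} → Decidable P → ℕ → ℕ
  χ P? i = 𝟙 (does (P? i))

  countBelow : ∀ {p} {P : Pred ℕ p} → Decidable P → ℕ → ℕ
  countBelow P? n = ∑[ i < n ] χ P? i

  ∑≥+∑<≡∑ : ∀ (f : ℕ → ℕ) {a n} → a ≤ n →
            (∑[ b < n ] (𝟙 (does (a ≤? b)) * f b)) + ∑< a f ≡ ∑< n f
  ∑≥+∑<≡∑ f {n = zero} z≤n = refl
  ∑≥+∑<≡∑ f {a} {n = suc n} a≤1+n with m≤n⇒m<n∨m≡n a≤1+n
  ... | inj₂ refl =
    cong (_+ ∑< (suc n) f)
         (∑-zero (suc n) (λ b b<a → cong (λ t → 𝟙 t * f b) (dec-false (suc n ≤? b) (<⇒≱ b<a))))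
  ... | inj₁ (s≤s a≤n) = begin
      S + 𝟙 (does (a ≤? n)) * f n + ∑< a f
    ≡⟨ cong (λ t → S + 𝟙 t * f n + ∑< a f) (dec-true (a ≤? n) a≤n) ⟩
      S + (f n + 0) + ∑< a f
    ≡⟨ cong (λ t → S + t + ∑< a f) (+-identityʳ (f n)) ⟩
      S + f n + ∑< a f
    ≡⟨ xy∙z≈xz∙y S (f n) (∑< a f) ⟩
      S + ∑< a f + f n
    ≡⟨ cong (_+ f n) (∑≥+∑<≡∑ f a≤n) ⟩
      ∑< n f + f n
    ∎
    where
    S : ℕ
    S = ∑[ b < n ] (𝟙 (does (a ≤? b)) * f b)

  C2-suc : ∀ c → suc c C 2 ≡ c C 2 + c
  C2-suc c = trans (sym (nCk+nC[k+1]≡[n+1]C[k+1] c 1)) (trans (cong (_+ c C 2) (nC1≡n c)) (+-comm c _))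

  ∑-χ-pairs : ∀ {p} {P : Pred ℕ p} (P? : Decidable P) n →
              ∑[ a < n ] (χ P? a * countBelow P? a) ≡ countBelow P? n C 2
  ∑-χ-pairs P? zero    = refl
  ∑-χ-pairs P? (suc n) =
    trans (cong (_+ χ P? n * c) (∑-χ-pairs P? n)) (add-element (does (P? n)))
    where
    c : ℕ
    c = countBelow P? n
    add-element : ∀ b → c C 2 + 𝟙 b * c ≡ (c + 𝟙 b) C 2
    add-element false = trans (+-identityʳ _) (sym (cong (_C 2) (+-identityʳ c)))
    add-element true  =
      trans (cong (c C 2 +_) (+-identityʳ c)) (trans (sym (C2-suc c)) (cong (_C 2) (+-comm 1 c)))

  upTo-suc : ∀ n → upTo (suc n) ≡ upTo n ++ [ n ]
  upTo-suc n = sym (upTo-∷ʳ n)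

  sum-map-upTo : ∀ (f : ℕ → ℕ) n → sum (map f (upTo n)) ≡ ∑< n f
  sum-map-upTo f zero    = refl
  sum-map-upTo f (suc n) = begin
      sum (map f (upTo (suc n)))
    ≡⟨ cong (sum ∘ map f) (upTo-suc n) ⟩
      sum (map f (upTo n ++ [ n ]))
    ≡⟨ cong sum (map-++ f (upTo n) [ n ]) ⟩
      sum (map f (upTo n) ++ [ f n ])
    ≡⟨ sum-++ (map f (upTo n)) [ f n ] ⟩
      sum (map f (upTo n)) + (f n + 0)
    ≡⟨ cong₂ _+_ (sum-map-upTo f n) (+-identityʳ (f n)) ⟩
      ∑< n f + f n
    ∎

  sum-map-filter-upTo : ∀ {p} {P : Pred ℕ p} (P? : Decidable P) (f : ℕ → ℕ) n →
                        sum (map f (filter P? (upTo n))) ≡ ∑[ i < n ] (χ P? i * f i)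
  sum-map-filter-upTo P? f zero    = refl
  sum-map-filter-upTo P? f (suc n) = begin
      sum (map f (filter P? (upTo (suc n))))
    ≡⟨ cong (sum ∘ map f ∘ filter P?) (upTo-suc n) ⟩
      sum (map f (filter P? (upTo n ++ [ n ])))
    ≡⟨ cong (sum ∘ map f) (filter-++ P? (upTo n) [ n ]) ⟩
      sum (map f (filter P? (upTo n) ++ filter P? [ n ]))
    ≡⟨ cong sum (map-++ f (filter P? (upTo n)) (filter P? [ n ])) ⟩
      sum (map f (filter P? (upTo n)) ++ map f (filter P? [ n ]))
    ≡⟨ sum-++ (map f (filter P? (upTo n))) (map f (filter P? [ n ])) ⟩
      sum (map f (filter P? (upTo n))) + sum (map f (filter P? [ n ]))
    ≡⟨ cong₂ _+_ (sum-map-filter-upTo P? f n) singleton ⟩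
      ∑[ i < suc n ] (χ P? i * f i)
    ∎
    where
    singleton : sum (map f (filter P? [ n ])) ≡ χ P? n * f n
    singleton with does (P? n)
    ... | true  = refl
    ... | false = refl

  length≡sum-map-1 : ∀ {a} {A : Set a} (xs : List A) → length xs ≡ sum (map (λ _ → 1) xs)
  length≡sum-map-1 []       = refl
  length≡sum-map-1 (x ∷ xs) = cong suc (length≡sum-map-1 xs)

  length-filter-upTo : ∀ {p} {P : Pred ℕ p} (P? : Decidable P) n →
                       length (filter P? (upTo n)) ≡ countBelow P? n
  length-filter-upTo P? n =
    trans (length≡sum-map-1 (filter P? (upTo n)))
          (trans (sum-map-filter-upTo P? _ n) (∑-cong n (λ i _ → *-identityʳ (χ P? i))))

  count≡countBelow : ∀ {S : DSet} (S? : Decidable S) y → count S? y ≡ countBelow S? (suc y)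
  count≡countBelow S? y = length-filter-upTo S? (suc y)

  sumIn-count : ∀ {S T : DSet} (S? : Decidable S) (T? : Decidable T) x h →
                sumIn S? (λ a → count T? (x ∸ a)) h
                ≡ ∑[ a < suc h ] (χ S? a * countBelow T? (suc (x ∸ a)))
  sumIn-count S? T? x h =
    trans (sum-map-filter-upTo S? _ (suc h))
          (∑-cong (suc h) (λ a _ → cong (χ S? a *_) (count≡countBelow T? (x ∸ a))))

module Representations {L M : DSet} (L? : Decidable L) (M? : Decidable M) where
  open import Data.Bool using (true; false; _∧_; _∨_)
  open import Data.Nat
  open import Data.Nat.Combinatorics using (_C_)
  open import Data.Nat.Divisibility using (_∣_; divides; ∣m∣n⇒∣m+n)
  open import Data.Nat.Properties
  open import Data.Nat.Tactic.RingSolver using (solve-∀)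
  open import Data.Product using (_×_; _,_)
  open import Data.Sum using (_⊎_; inj₁; inj₂)
  open import Function using (_∘_)
  open import Relation.Nullary using (Dec; ¬_; does)
  open import Relation.Nullary.Decidable using (dec-false; _×-dec_; _⊎-dec_)
  open import Relation.Binary.PropositionalEquality
  open ≡-Reasoning
  open FiniteSums

  Z? : Decidable (L ∩ M)
  Z? = L? ∩? M?

  -- The same decision procedure as inside reprAt?, so that e unfolds to a sum of ρ.
  R? : ∀ a b → Dec ((L a × M b) ⊎ (M a × L b))
  R? a b = (L? a ×-dec M? b) ⊎-dec (M? a ×-dec L? b)

  ρ : ℕ → ℕ → ℕ
  ρ a b = 𝟙 (does (R? a b))

  ρ≤ : ℕ → ℕ → ℕ
  ρ≤ a b = 𝟙 (does (a ≤? b)) * ρ a b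

  𝟙-inclusion-exclusion : ∀ l m l′ m′ →
    𝟙 ((l ∧ m′) ∨ (m ∧ l′)) + 𝟙 (l ∧ m) * 𝟙 (l′ ∧ m′) ≡ 𝟙 m * 𝟙 l′ + 𝟙 l * 𝟙 m′
  𝟙-inclusion-exclusion false false _     _     = refl
  𝟙-inclusion-exclusion false true  false _     = refl
  𝟙-inclusion-exclusion false true  true  _     = refl
  𝟙-inclusion-exclusion true  false _     false = refl
  𝟙-inclusion-exclusion true  false _     true  = refl
  𝟙-inclusion-exclusion true  true  false false = refl
  𝟙-inclusion-exclusion true  true  false true  = refl
  𝟙-inclusion-exclusion true  true  true  false = refl
  𝟙-inclusion-exclusion true  true  true  true  = refl

  ρ-inclusion-exclusion : ∀ a b → ρ a b + χ Z? a * χ Z? b ≡ χ M? a * χ L? b + χ L? a * χ M? b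
  ρ-inclusion-exclusion a b =
    𝟙-inclusion-exclusion (does (L? a)) (does (M? a)) (does (L? b)) (does (M? b))

  e≡∑ρ≤ : ∀ x → e L? M? x ≡ ∑[ a < suc x ] ρ≤ a (x ∸ a)
  e≡∑ρ≤ x = trans (length-filter-upTo (reprAt? L? M? x) (suc x))
                  (∑-cong (suc x) (λ a _ → 𝟙-∧ (does (a ≤? x ∸ a)) (does (R? a (x ∸ a)))))

  ∑e≡∑∑ρ≤ : ∀ x → ∑[ y < suc x ] e L? M? y ≡ ∑[ a < suc x ] ∑[ b < suc (x ∸ a) ] ρ≤ a b
  ∑e≡∑∑ρ≤ x = trans (∑-cong (suc x) (λ y _ → e≡∑ρ≤ y)) (∑-antidiagonals ρ≤ x)

  ∑ρ-row : ∀ a n → (∑[ b < n ] ρ a b) + χ Z? a * countBelow Z? n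
                   ≡ χ M? a * countBelow L? n + χ L? a * countBelow M? n
  ∑ρ-row a n = begin
      (∑[ b < n ] ρ a b) + χ Z? a * countBelow Z? n
    ≡⟨ cong ((∑[ b < n ] ρ a b) +_) (∑-*ˡ (χ Z? a) (χ Z?) n) ⟨
      (∑[ b < n ] ρ a b) + (∑[ b < n ] (χ Z? a * χ Z? b))
    ≡⟨ ∑-distrib-+ (ρ a) (λ b → χ Z? a * χ Z? b) n ⟨
      ∑[ b < n ] (ρ a b + χ Z? a * χ Z? b)
    ≡⟨ ∑-cong n (λ b _ → ρ-inclusion-exclusion a b) ⟩
      ∑[ b < n ] (χ M? a * χ L? b + χ L? a * χ M? b)
    ≡⟨ ∑-distrib-+ (λ b → χ M? a * χ L? b) (λ b → χ L? a * χ M? b) n ⟩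
      (∑[ b < n ] (χ M? a * χ L? b)) + (∑[ b < n ] (χ L? a * χ M? b))
    ≡⟨ cong₂ _+_ (∑-*ˡ (χ M? a) (χ L?) n) (∑-*ˡ (χ L? a) (χ M?) n) ⟩
      χ M? a * countBelow L? n + χ L? a * countBelow M? n
    ∎

  ∑ρ-below-diagonal : ∀ n → (∑[ a < n ] ∑[ b < a ] ρ a b) + suc (countBelow Z? n) C 2
                            ≡ countBelow L? n * countBelow M? n
  ∑ρ-below-diagonal n = begin
      S + suc Zn C 2
    ≡⟨ cong (S +_) (C2-suc Zn) ⟩
      S + (Zn C 2 + Zn)
    ≡⟨ cong (λ t → S + (t + Zn)) (∑-χ-pairs Z? n) ⟨
      S + (W + Zn)
    ≡⟨ +-assoc S W Zn ⟨
      S + W + Zn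
    ≡⟨ cong (_+ Zn) (∑-distrib-+ (λ a → ∑[ b < a ] ρ a b) (λ a → χ Z? a * countBelow Z? a) n) ⟨
      (∑[ a < n ] ((∑[ b < a ] ρ a b) + χ Z? a * countBelow Z? a)) + Zn
    ≡⟨ cong₂ _+_ (∑-cong n (λ a _ → ∑ρ-row a a)) (∑-cong n (λ a _ → χZ≡χM*χL a)) ⟩
      (∑[ a < n ] (χ M? a * countBelow L? a + χ L? a * countBelow M? a))
        + (∑[ a < n ] (χ M? a * χ L? a))
    ≡⟨ ∑*∑ (χ M?) (χ L?) n ⟨
      countBelow M? n * countBelow L? n
    ≡⟨ *-comm (countBelow M? n) _ ⟩
      countBelow L? n * countBelow M? n
    ∎
    where
    S W Zn : ℕ
    S  = ∑[ a < n ] ∑[ b < a ] ρ a b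
    W  = ∑[ a < n ] (χ Z? a * countBelow Z? a)
    Zn = countBelow Z? n
    χZ≡χM*χL : ∀ a → χ Z? a ≡ χ M? a * χ L? a
    χZ≡χM*χL a = trans (𝟙-∧ (does (L? a)) (does (M? a))) (*-comm (χ L? a) _)

  ∑ρ≤-beyond-half : ∀ h a → h < a → ∑[ b < suc (2 * h ∸ a) ] ρ≤ a b ≡ 0
  ∑ρ≤-beyond-half h a h<a = ∑-zero (suc (2 * h ∸ a)) (λ b b<N →
    cong (λ t → 𝟙 t * ρ a b) (dec-false (a ≤? b) (λ a≤b → <⇒≱ h<a (≤-trans a≤b (≤h b<N)))))
    where
    2h∸[1+h]≤h : 2 * h ∸ suc h ≤ h
    2h∸[1+h]≤h = m≤n+o⇒m∸n≤o (2 * h) (suc h) (m≤n⇒m≤1+n (≤-reflexive (cong (h +_) (+-identityʳ h))))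
    ≤h : ∀ {b} → b < suc (2 * h ∸ a) → b ≤ h
    ≤h (s≤s b≤2h∸a) = ≤-trans b≤2h∸a (≤-trans (∸-monoʳ-≤ (2 * h) h<a) 2h∸[1+h]≤h)

  ∑ρ≤+∑ρ≡∑ρ : ∀ h a → a ≤ h →
    (∑[ b < suc (2 * h ∸ a) ] ρ≤ a b) + (∑[ b < a ] ρ a b) ≡ ∑[ b < suc (2 * h ∸ a) ] ρ a b
  ∑ρ≤+∑ρ≡∑ρ h a a≤h =
    ∑≥+∑<≡∑ (ρ a) (m≤n⇒m≤1+n (m+n≤o⇒m≤o∸n a (+-mono-≤ a≤h (≤-trans a≤h (m≤m+n h 0)))))

  cumulative-identity : ∀ h →
    (∑[ y < suc (2 * h) ] e L? M? y)
      + (∑[ a < suc h ] (χ Z? a * countBelow Z? (suc (2 * h ∸ a))))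
      + countBelow L? (suc h) * countBelow M? (suc h)
    ≡ (∑[ a < suc h ] (χ M? a * countBelow L? (suc (2 * h ∸ a))))
      + (∑[ a < suc h ] (χ L? a * countBelow M? (suc (2 * h ∸ a))))
      + suc (countBelow Z? (suc h)) C 2
  cumulative-identity h = begin
      (∑[ y < suc (2 * h) ] e L? M? y) + ∑< k Cz + countBelow L? k * countBelow M? k
    ≡⟨ cong₂ (λ s t → s + ∑< k Cz + t) ∑e≡∑V (sym (∑ρ-below-diagonal k)) ⟩
      ∑< k V + ∑< k Cz + (∑< k S + G)
    ≡⟨ regroup (∑< k V) (∑< k Cz) (∑< k S) G ⟩
      ∑< k V + ∑< k S + ∑< k Cz + G
    ≡⟨ cong (_+ G) columns ⟩
      ∑< k A + ∑< k B + G
    ∎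
    where
    k G : ℕ
    k = suc h
    G = suc (countBelow Z? k) C 2
    V S Cz A B : ℕ → ℕ
    V  a = ∑[ b < suc (2 * h ∸ a) ] ρ≤ a b
    S  a = ∑[ b < a ] ρ a b
    Cz a = χ Z? a * countBelow Z? (suc (2 * h ∸ a))
    A  a = χ M? a * countBelow L? (suc (2 * h ∸ a))
    B  a = χ L? a * countBelow M? (suc (2 * h ∸ a))
    regroup : ∀ v c s g → v + c + (s + g) ≡ v + s + c + g
    regroup = solve-∀
    ∑e≡∑V : ∑[ y < suc (2 * h) ] e L? M? y ≡ ∑< k V
    ∑e≡∑V = trans (∑e≡∑∑ρ≤ (2 * h))
                  (∑-vanishing-tail V (s≤s (m≤m+n h (h + 0))) (∑ρ≤-beyond-half h))
    columns : ∑< k V + ∑< k S + ∑< k Cz ≡ ∑< k A + ∑< k B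
    columns = begin
        ∑< k V + ∑< k S + ∑< k Cz
      ≡⟨ cong (_+ ∑< k Cz) (∑-distrib-+ V S k) ⟨
        (∑[ a < k ] (V a + S a)) + ∑< k Cz
      ≡⟨ ∑-distrib-+ (λ a → V a + S a) Cz k ⟨
        ∑[ a < k ] (V a + S a + Cz a)
      ≡⟨ ∑-cong k (λ { a (s≤s a≤h) →
           trans (cong (_+ Cz a) (∑ρ≤+∑ρ≡∑ρ h a a≤h)) (∑ρ-row a (suc (2 * h ∸ a))) }) ⟩
        ∑[ a < k ] (A a + B a)
      ≡⟨ ∑-distrib-+ A B k ⟩
        ∑< k A + ∑< k B
      ∎

  module _ (L-even : ∀ {n} → L n → 2 ∣ n) (M-even : ∀ {n} → M n → 2 ∣ n) where

    R⇒2∣+ : ∀ {a b} → (L a × M b) ⊎ (M a × L b) → 2 ∣ a + b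
    R⇒2∣+ (inj₁ (La , Mb)) = ∣m∣n⇒∣m+n (L-even La) (M-even Mb)
    R⇒2∣+ (inj₂ (Ma , Lb)) = ∣m∣n⇒∣m+n (M-even Ma) (L-even Lb)

    e-odd : ∀ k → e L? M? (suc (2 * k)) ≡ 0
    e-odd k = trans (e≡∑ρ≤ y) (∑-zero (suc y) no-representation)
      where
      y : ℕ
      y = suc (2 * k)
      odd : ¬ 2 ∣ y
      odd (divides q y≡q*2) = even≢odd q k (trans (*-comm 2 q) (sym y≡q*2))
      no-representation : ∀ a → a < suc y → ρ≤ a (y ∸ a) ≡ 0
      no-representation a (s≤s a≤y) =
        trans (cong (λ t → 𝟙 (does (a ≤? y ∸ a)) * 𝟙 t)
                    (dec-false (R? a (y ∸ a)) (odd ∘ subst (2 ∣_) (m+[n∸m]≡n a≤y) ∘ R⇒2∣+)))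
              (*-zeroʳ (𝟙 (does (a ≤? y ∸ a))))

    e+ePrevSum≡∑e : ∀ h → e L? M? (2 * h) + ePrevSum L? M? (2 * h) h ≡ ∑[ y < suc (2 * h) ] e L? M? y
    e+ePrevSum≡∑e h = begin
        E (2 * h) + ePrevSum L? M? (2 * h) h
      ≡⟨ cong (E (2 * h) +_) (sum-map-upTo _ h) ⟩
        E (2 * h) + (∑[ k < h ] E (2 * h ∸ 2 * suc k))
      ≡⟨ cong (E (2 * h) +_) (∑-cong h (λ k _ → cong E (*-distribˡ-∸ 2 h (suc k)))) ⟨
        E (2 * h) + (∑[ k < h ] E (2 * (h ∸ suc k)))
      ≡⟨ cong (E (2 * h) +_) (∑-reverse (λ k → E (2 * k)) h) ⟩
        E (2 * h) + (∑[ k < h ] E (2 * k))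
      ≡⟨ +-comm (E (2 * h)) _ ⟩
        ∑[ k < suc h ] E (2 * k)
      ≡⟨ ∑-even-terms E e-odd h ⟩
        ∑[ y < suc (2 * h) ] E y
      ∎
      where
      E : ℕ → ℕ
      E = e L? M?

    e-identity : ∀ {x} h → x ≡ 2 * h →
      e L? M? x + ePrevSum L? M? x h + sumIn Z? (λ z → count Z? (x ∸ z)) h
        + count L? h * count M? h
      ≡ sumIn M? (λ m → count L? (x ∸ m)) h + sumIn L? (λ l → count M? (x ∸ l)) h
        + suc (count Z? h) C 2
    e-identity h refl =
      trans (cong₂ _+_ (cong₂ _+_ (e+ePrevSum≡∑e h) (sumIn-count Z? Z? (2 * h) h))
                       (cong₂ _*_ (count≡countBelow L? h) (count≡countBelow M? h)))
            (trans (cumulative-identity h)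
                   (sym (cong₂ _+_ (cong₂ _+_ (sumIn-count M? L? (2 * h) h)
                                              (sumIn-count L? M? (2 * h) h))
                                   (cong (λ c → suc c C 2) (count≡countBelow Z? h)))))

open import Data.Integer using (+_; _+_; _-_; _*_)
open import Data.Integer.Properties using (pos-+; pos-*)
open import Data.Integer.Tactic.RingSolver using (solve-∀)
open import Data.Nat using (ℕ; suc; _≤_; _∸_; _/_)
import Data.Nat as ℕ
open import Data.Nat.Combinatorics using (_C_)
open import Data.Nat.Divisibility using (_∣_)
open import Data.Nat.DivMod using (m*[n/m]≡n)
open import Data.Product using (proj₂)
open import Function using (_∘_)
open import Relation.Binary.PropositionalEquality

ℕ-identity⇒ℤ : ∀ r p c l m a b g →
  r ℕ.+ p ℕ.+ c ℕ.+ l ℕ.* m ≡ a ℕ.+ b ℕ.+ g →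
  + r ≡ + a + + b - + c - + l * + m + + g - + p
ℕ-identity⇒ℤ r p c l m a b g eq = begin
    + r
  ≡⟨ isolate (+ r) (+ p) (+ c) (+ l) (+ m) ⟩
    + r + + p + + c + + l * + m - + p - + c - + l * + m
  ≡⟨ cong (λ t → t - + p - + c - + l * + m) (trans (sym lhs) (trans (cong +_ eq) rhs)) ⟩
    + a + + b + + g - + p - + c - + l * + m
  ≡⟨ rearrange (+ a) (+ b) (+ c) (+ l) (+ m) (+ g) (+ p) ⟩
    + a + + b - + c - + l * + m + + g - + p
  ∎
  where
  open ≡-Reasoning
  isolate : ∀ r p c l m → r ≡ r + p + c + l * m - p - c - l * m
  isolate = solve-∀
  rearrange : ∀ a b c l m g p → a + b + g - p - c - l * m ≡ a + b - c - l * m + g - p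
  rearrange = solve-∀
  lhs : + (r ℕ.+ p ℕ.+ c ℕ.+ l ℕ.* m) ≡ + r + + p + + c + + l * + m
  lhs = trans (pos-+ (r ℕ.+ p ℕ.+ c) (l ℕ.* m))
              (cong₂ _+_ (trans (pos-+ (r ℕ.+ p) c) (cong (_+ + c) (pos-+ r p))) (pos-* l m))
  rhs : + (a ℕ.+ b ℕ.+ g) ≡ + a + + b + + g
  rhs = trans (pos-+ (a ℕ.+ b) g) (cong (_+ + g) (pos-+ a b))

theorem2 : (L M : DSet) (L? : Decidable L) (M? : Decidable M) →
    PosEvenSet L → PosEvenSet M →
    (x : ℕ) → 2 ∣ x → 2 ≤ x →
    + e L? M? x ≡
      + sumIn M? (λ m → count L? (x ∸ m)) (x / 2)
      + + sumIn L? (λ l → count M? (x ∸ l)) (x / 2)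
      - + sumIn (L? ∩? M?) (λ z → count (L? ∩? M?) (x ∸ z)) (x / 2)
      - + count L? (x / 2) * + count M? (x / 2)
      + + ((suc (count (L? ∩? M?) (x / 2))) C 2)
      - + ePrevSum L? M? x (x / 2)
theorem2 L M L? M? L-pos-even M-pos-even x 2∣x _ =
  ℕ-identity⇒ℤ (e L? M? x) (ePrevSum L? M? x h) (sumIn Z? (λ z → count Z? (x ∸ z)) h)
               (count L? h) (count M? h)
               (sumIn M? (λ m → count L? (x ∸ m)) h) (sumIn L? (λ l → count M? (x ∸ l)) h)
               (suc (count Z? h) C 2)
               (Representations.e-identity L? M? (proj₂ ∘ L-pos-even _) (proj₂ ∘ M-pos-even _)
                                           h (sym (m*[n/m]≡n 2∣x)))
  where
  h : ℕ
  h = x / 2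
  Z? : Decidable (L ∩ M)
  Z? = L? ∩? M?
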